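{- Work in Incomprehensive Set Theory (defined in the context). If $x$ is an upper, then $x^{ -- }$ is an upper.
   Context: Incomprehensive Set Theory is the first-order theory in the language $\{\in,=\}$ whose only axioms are: Existence of Successor, $\forall x\,\exists! y\,\forall z\,(z\in y \iff z\in x \lor z=x)$; and Existence of Predecessor, $\forall x\,\exists! y\,\forall z\,(z\in y\iff z\in x\wedge z\neq x)$. The unique $y$ in the second axiom is written $x^{ -- }$. An object $x$ is an upper if $\forall z\,(z\notin z\Rightarrow z\in x)$. -}

module Defs where

open import Level using (Level; suc; _⊔_)
open import Data.Product using (Σ; proj₁; _×_)
open import Data.Sum using (_⊎_)
open import Relation.Nullary using (¬_)
open import Relation.Binary.PropositionalEquality using (_≡_)
open import Function.Bundles using (_⇔_)

∃! : ∀ {a p} {A : Set a} → (A → Set p) → Set (a ⊔ p)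
∃! {A = A} P = Σ A (λ y → P y × (∀ y' → P y' → y ≡ y'))

-- A model of Incomprehensive Set Theory: a domain with a binary
-- relation ∈ (equality interpreted as identity) satisfying the two axioms.
record IST (a ℓ : Level) : Set (suc (a ⊔ ℓ)) where
  field
    U    : Set a
    _∈_  : U → U → Set ℓ
    succ-ax : ∀ x → ∃! (λ y → ∀ z → (z ∈ y) ⇔ ((z ∈ x) ⊎ (z ≡ x)))
    pred-ax : ∀ x → ∃! (λ y → ∀ z → (z ∈ y) ⇔ ((z ∈ x) × ¬ (z ≡ x)))

  _⁻⁻ : U → U
  x ⁻⁻ = proj₁ (pred-ax x)

  Upper : U → Set (a ⊔ ℓ)
  Upper x = ∀ z → ¬ (z ∈ z) → z ∈ x

{-# OPTIONS --safe #-}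
module Submission where

open import Defs
open import Data.Product using (proj₁; proj₂; _,_)
open import Function.Bundles using (Equivalence)
open import Relation.Nullary using (¬_)
open import Relation.Binary.PropositionalEquality using (_≡_; refl)

module _ {a ℓ} (M : IST a ℓ) where
  open IST M

  ∈-⁻⁻ : ∀ {x z} → z ∈ x → ¬ z ≡ x → z ∈ (x ⁻⁻)
  ∈-⁻⁻ {x} {z} z∈x z≢x = Equivalence.from (proj₁ (proj₂ (pred-ax x)) z) (z∈x , z≢x)

  ∉-self∧∈⇒≢ : ∀ {x z} → ¬ z ∈ z → z ∈ x → ¬ z ≡ x
  ∉-self∧∈⇒≢ z∉z z∈x refl = z∉z z∈x

lemma4p4 : ∀ {a ℓ} (M : IST a ℓ) → (x : IST.U M) → IST.Upper M x → IST.Upper M (IST._⁻⁻ M x)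
lemma4p4 M x up z z∉z = ∈-⁻⁻ M z∈x (∉-self∧∈⇒≢ M z∉z z∈x)
  where
  z∈x : IST._∈_ M z x
  z∈x = up z z∉z
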